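{- Let $n_1,\ldots,n_k,n_{k+1}$ be positive integers. If $B(n_1,\ldots,n_k,n_{k+1})$ is good and $n_{k+1} > 2^k$, then $B(n_1,\ldots,n_k)$ is good.
   Context: For positive integers $m$, $[m]=\{1,\ldots,m\}$. For positive integers $n_1,\ldots,n_k$, the box is $B(n_1,\ldots,n_k) = [2n_1]\times\cdots\times[2n_k]$, and $\partial B(n_1,\ldots,n_k)$ is the set of $x \in B(n_1,\ldots,n_k)$ with $x_i \in \{1, 2n_i\}$ for some $i \in [k]$. For $x,y$ in the box, write $x \sim y$ if $x=y$ or $|x_i-y_i|=1$ for some $i$. A box $B(n_1,\ldots,n_k)$ (of dimension $k$) is good if there is a subset $S \subseteq \partial B(n_1,\ldots,n_k)$ with $|S| = 2^k$ and $x\sim y$ for all $x,y\in S$. -}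

module Defs where

open import Data.Nat using (ℕ; suc; _≤_; _*_; _^_; ∣_-_∣)
open import Data.Fin using (Fin)
open import Data.Vec using (Vec; lookup)
open import Data.List using (List; length)
open import Data.List.Relation.Unary.All using (All)
open import Data.List.Relation.Unary.Unique.Propositional using (Unique)
open import Data.Product using (Σ; ∃; _×_)
open import Data.Sum using (_⊎_)
open import Relation.Binary.PropositionalEquality using (_≡_)

-- A point of ℕ^k, given as a vector (so equality is decidable/extensional).
Point : ℕ → Set
Point k = Vec ℕ k

InBox : ∀ {k} → Vec ℕ k → Point k → Set
InBox {k} ns x = (i : Fin k) → 1 ≤ lookup x i × lookup x i ≤ 2 * lookup ns i

InBoundary : ∀ {k} → Vec ℕ k → Point k → Set
InBoundary {k} ns x = InBox ns x × ∃ λ (i : Fin k) → (lookup x i ≡ 1 ⊎ lookup x i ≡ 2 * lookup ns i)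

_∼_ : ∀ {k} → Point k → Point k → Set
_∼_ {k} x y = (x ≡ y) ⊎ (∃ λ (i : Fin k) → ∣ lookup x i - lookup y i ∣ ≡ 1)

Good : ∀ {k} → Vec ℕ k → Set
Good {k} ns = Σ (List (Point k)) λ S →
  Unique S × length S ≡ 2 ^ k × All (InBoundary ns) S ×
  All (λ x → All (λ y → x ∼ y) S) S

AllPos : ∀ {k} → Vec ℕ k → Set
AllPos {k} ns = (i : Fin k) → 1 ≤ lookup ns i

-- Pairwise adjacent points of ℕ^k number at most 2^k: within a parity class of the first
-- coordinate that coordinate never differs by exactly 1, so each class stays pairwise adjacent
-- after dropping it.
--
-- In a good B(n_1,…,n_k,m) the 2^(k+1) points of S leave some c ∈ [1, 2m] unused as a last
-- coordinate, since 2^(k+1) < 2m. Colouring a point by the parity of its last coordinate after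
-- punching a hole at c again keeps equal colours from differing by 1 there, so both colour classes
-- project to pairwise adjacent sets in ℕ^k and hence have exactly 2^k points each. The face values
-- 1 and 2m both get odd colour, so the even class projects into ∂B(n_1,…,n_k).
module Submission where

open import Defs
open import Data.Nat using (ℕ; zero; suc; _+_; _*_; _^_; _<_; _≤_; ∣_-_∣; z≤n; s≤s; parity)
open import Data.Vec using (Vec; []; _∷_; _∷ʳ_; lookup; head; tail; init; last; initLast)

open import Data.Empty using (⊥-elim)
open import Data.Fin using (Fin; zero; suc; toℕ)
open import Data.Fin.Properties using (toℕ<n; toℕ-injective; ¬∀⟶∃¬; injective⇒≤)
open import Data.List using (List; []; _∷_; length; map; filter)
open import Data.List.Membership.DecPropositional Data.Nat._≟_ using (_∈_; _∉_; _∈?_)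
open import Data.List.Membership.Setoid.Properties using (index-injective)
open import Data.List.Properties using (length-map)
open import Data.List.Relation.Unary.All as All using (All; []; _∷_)
open import Data.List.Relation.Unary.All.Properties as All using (all-filter; ¬Any⇒All¬)
open import Data.List.Relation.Unary.AllPairs as AllPairs using (AllPairs; []; _∷_)
import Data.List.Relation.Unary.AllPairs.Properties as AllPairs
open import Data.List.Relation.Unary.Any using (index)
open import Data.List.Relation.Unary.Unique.Propositional using (Unique)
open import Data.Nat.Properties
  using (suc-injective; ≤-antisym; +-suc; +-cancelʳ-≤; +-monoʳ-≤; +-mono-≤; +-identityʳ;
         *-monoʳ-<; <⇒≱; ≤∧≢⇒<; ∣-∣-comm; ∣n-n∣≡0; 0≢1+n; module ≤-Reasoning)
open import Data.Parity.Base using (Parity; 0ℙ; 1ℙ; _⁻¹)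
open import Data.Parity.Properties as ℙ using (suc-homo-⁻¹; +-homo-+; *-homo-*)
open import Data.Product as Product using (∃; _×_; _,_; proj₂; uncurry)
open import Data.Sum as Sum using (_⊎_; inj₁; inj₂; [_,_]′)
open import Function using (_∘_; id)
open import Function.Definitions using (Injective)
open import Relation.Binary.Definitions using (Reflexive; Symmetric)
open import Relation.Binary.PropositionalEquality
  using (_≡_; _≢_; refl; sym; trans; cong; cong₂; subst; subst₂; setoid; module ≡-Reasoning)
open import Relation.Nullary using (¬_; contradiction)

module _ {A : Set} where

  All⇒AllPairs : ∀ {P : A → Set} {xs} → All P xs → AllPairs (λ x y → P x × P y) xs
  All⇒AllPairs []         = []
  All⇒AllPairs (px ∷ pxs) = All.map (px ,_) pxs ∷ All⇒AllPairs pxs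

  AllAll⇒AllPairs : ∀ {R : A → A → Set} {xs} → All (λ x → All (R x) xs) xs → AllPairs R xs
  AllAll⇒AllPairs {xs = []}    []              = []
  AllAll⇒AllPairs {xs = _ ∷ _} ((_ ∷ rx) ∷ rxs) = rx ∷ AllAll⇒AllPairs (All.map All.tail rxs)

  AllPairs⇒AllAll : ∀ {R : A → A → Set} → Reflexive R → Symmetric R →
                    ∀ {xs} → AllPairs R xs → All (λ x → All (R x) xs) xs
  AllPairs⇒AllAll r s []         = []
  AllPairs⇒AllAll r s (rx ∷ rxs) =
    (r ∷ rx) ∷ All.zipWith (λ (rxy , ry) → s rxy ∷ ry) (rx , AllPairs⇒AllAll r s rxs)

  colourClass : (A → Parity) → Parity → List A → List A
  colourClass colour p = filter (λ x → colour x ℙ.≟ p)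

  length-colourClasses : ∀ (colour : A → Parity) xs →
    length (colourClass colour 0ℙ xs) + length (colourClass colour 1ℙ xs) ≡ length xs
  length-colourClasses colour []       = refl
  length-colourClasses colour (x ∷ xs) with colour x
  ... | 0ℙ = cong suc (length-colourClasses colour xs)
  ... | 1ℙ = trans (+-suc _ _) (cong suc (length-colourClasses colour xs))

  module _ {B : Set} (colour : A → Parity) (f : A → B) (p : Parity) where

    All-map-colourClass : ∀ {P : A → Set} {Q : B → Set} → (∀ {x} → colour x ≡ p → P x → Q (f x)) →
                          ∀ {xs} → All P xs → All Q (map f (colourClass colour p xs))
    All-map-colourClass h {xs} pxs =
      All.map⁺ (All.zipWith (uncurry h) (all-filter _ xs , All.filter⁺ _ pxs))

    AllPairs-map-colourClass : ∀ {R : A → A → Set} {S : B → B → Set} →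
      (∀ {x y} → colour x ≡ colour y → R x y → S (f x) (f y)) →
      ∀ {xs} → AllPairs R xs → AllPairs S (map f (colourClass colour p xs))
    AllPairs-map-colourClass h {xs} rs =
      AllPairs.map⁺ (AllPairs.zipWith (λ ((cx , cy) , r) → h (trans cx (sym cy)) r)
                                      (All⇒AllPairs (all-filter _ xs) , AllPairs.filter⁺ _ rs))

length<⇒∃∉ : ∀ n (xs : List ℕ) → length xs < n → ∃ λ c → 1 ≤ c × c ≤ n × c ∉ xs
length<⇒∃∉ n xs |xs|<n =
  let i , i∉xs = ¬∀⟶∃¬ n _ (λ i → suc (toℕ i) ∈? xs) ¬all∈
  in suc (toℕ i) , s≤s z≤n , toℕ<n i , i∉xs
  where
  ¬all∈ : ¬ (∀ (i : Fin n) → suc (toℕ i) ∈ xs)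
  ¬all∈ all∈ = <⇒≱ |xs|<n (injective⇒≤ position-injective)
    where
    position-injective : Injective _≡_ _≡_ (λ i → index (all∈ i))
    position-injective eq =
      toℕ-injective (suc-injective (index-injective (setoid ℕ) (all∈ _) (all∈ _) eq))

2^suc≡2^+2^ : ∀ k → 2 ^ suc k ≡ 2 ^ k + 2 ^ k
2^suc≡2^+2^ k = cong (2 ^ k +_) (+-identityʳ (2 ^ k))

m+n≡o+o⇒m≡o : ∀ {m n o} → m ≤ o → n ≤ o → m + n ≡ o + o → m ≡ o
m+n≡o+o⇒m≡o {m} {n} {o} m≤o n≤o eq = ≤-antisym m≤o (+-cancelʳ-≤ o o m (begin
  o + o ≡⟨ sym eq ⟩
  m + n ≤⟨ +-monoʳ-≤ m n≤o ⟩
  m + o ∎))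
  where open ≤-Reasoning

∣m-n∣≡1⇒parity≢ : ∀ m n → ∣ m - n ∣ ≡ 1 → parity m ≢ parity n
∣m-n∣≡1⇒parity≢ zero       (suc zero) _    = λ ()
∣m-n∣≡1⇒parity≢ (suc zero) zero       _    = λ ()
∣m-n∣≡1⇒parity≢ (suc m)    (suc n)    d eq = ∣m-n∣≡1⇒parity≢ m n d
  (trans (sym (suc-homo-⁻¹ m)) (trans (cong _⁻¹ eq) (suc-homo-⁻¹ n)))

parity[1+2*m]≡1ℙ : ∀ m → parity (suc (2 * m)) ≡ 1ℙ
parity[1+2*m]≡1ℙ m = trans (+-homo-+ 1 (2 * m)) (cong _⁻¹ (*-homo-* 2 m))

-- The analogue on ℕ of Data.Fin.punchIn: punchIn c maps ℕ monotonically onto ℕ ∖ {c}.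
punchIn : ℕ → ℕ → ℕ
punchIn zero    a       = suc a
punchIn (suc c) zero    = zero
punchIn (suc c) (suc a) = suc (punchIn c a)

punchIn-< : ∀ {c a} → a < c → punchIn c a ≡ a
punchIn-< {suc c} {zero}  _         = refl
punchIn-< {suc c} {suc a} (s≤s a<c) = cong suc (punchIn-< a<c)

punchIn-≥ : ∀ {c a} → c ≤ a → punchIn c a ≡ suc a
punchIn-≥ {zero}          _         = refl
punchIn-≥ {suc c} {suc a} (s≤s c≤a) = cong suc (punchIn-≥ c≤a)

punchIn-∣-∣≡1 : ∀ c {a b} → c ≢ a → c ≢ b → ∣ a - b ∣ ≡ 1 → ∣ punchIn c a - punchIn c b ∣ ≡ 1
punchIn-∣-∣≡1 zero          _   _   d = d
punchIn-∣-∣≡1 (suc zero)    {zero}     {suc zero} _   c≢b _ = contradiction refl c≢b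
punchIn-∣-∣≡1 (suc (suc c)) {zero}     {suc zero} _   _   _ = refl
punchIn-∣-∣≡1 (suc zero)    {suc zero} {zero}     c≢a _   _ = contradiction refl c≢a
punchIn-∣-∣≡1 (suc (suc c)) {suc zero} {zero}     _   _   _ = refl
punchIn-∣-∣≡1 (suc c)       {suc a}    {suc b}    c≢a c≢b d =
  punchIn-∣-∣≡1 c (c≢a ∘ cong suc) (c≢b ∘ cong suc) d

parity-punchIn-face : ∀ {c a} m → 1 ≤ c → c ≤ 2 * m → c ≢ a → a ≡ 1 ⊎ a ≡ 2 * m →
                      parity (punchIn c a) ≡ 1ℙ
parity-punchIn-face m 1≤c _    c≢a (inj₁ refl) =
  cong parity (punchIn-< (≤∧≢⇒< 1≤c (c≢a ∘ sym)))
parity-punchIn-face m _   c≤2m _   (inj₂ refl) =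
  trans (cong parity (punchIn-≥ c≤2m)) (parity[1+2*m]≡1ℙ m)

module _ {A B : Set} (R : A → B → Set) where

  ∃-lookup-∷ʳ⁻ : ∀ {k} (xs : Vec A k) (ys : Vec B k) {a b} →
    ∃ (λ i → R (lookup (xs ∷ʳ a) i) (lookup (ys ∷ʳ b) i)) →
    ∃ (λ i → R (lookup xs i) (lookup ys i)) ⊎ R a b
  ∃-lookup-∷ʳ⁻ []       []       (zero , r)  = inj₂ r
  ∃-lookup-∷ʳ⁻ (x ∷ xs) (y ∷ ys) (zero , r)  = inj₁ (zero , r)
  ∃-lookup-∷ʳ⁻ (x ∷ xs) (y ∷ ys) (suc i , r) =
    Sum.map₁ (Product.map suc id) (∃-lookup-∷ʳ⁻ xs ys (i , r))

  ∀-lookup-∷ʳ⁻ : ∀ {k} (xs : Vec A k) (ys : Vec B k) {a b} →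
    (∀ i → R (lookup (xs ∷ʳ a) i) (lookup (ys ∷ʳ b) i)) →
    ∀ i → R (lookup xs i) (lookup ys i)
  ∀-lookup-∷ʳ⁻ (x ∷ xs) (y ∷ ys) r zero    = r zero
  ∀-lookup-∷ʳ⁻ (x ∷ xs) (y ∷ ys) r (suc i) = ∀-lookup-∷ʳ⁻ xs ys (r ∘ suc) i

init-∷ʳ-last : ∀ {A : Set} {k} (x : Vec A (suc k)) → init x ∷ʳ last x ≡ x
init-∷ʳ-last x = sym (proj₂ (proj₂ (initLast x)))

Adjacent : ∀ {k} → Point k → Point k → Set
Adjacent {k} x y = ∃ λ (i : Fin k) → ∣ lookup x i - lookup y i ∣ ≡ 1

Clique : ∀ {k} → List (Point k) → Set
Clique = AllPairs Adjacent

Adjacent-sym : ∀ {k} → Symmetric (Adjacent {k})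
Adjacent-sym {x = x} {y} (i , d) = i , trans (∣-∣-comm (lookup y i) (lookup x i)) d

Adjacent⇒≢ : ∀ {k} {x y : Point k} → Adjacent x y → x ≢ y
Adjacent⇒≢ {x = x} (i , d) refl = 0≢1+n (trans (sym (∣n-n∣≡0 (lookup x i))) d)

Adjacent-tail : ∀ {k} {x y : Point (suc k)} →
                Adjacent x y → ∣ head x - head y ∣ ≢ 1 → Adjacent (tail x) (tail y)
Adjacent-tail {x = _ ∷ _} {_ ∷ _} (zero , d)  ≢1 = contradiction d ≢1
Adjacent-tail {x = _ ∷ _} {_ ∷ _} (suc i , d) _  = i , d

Adjacent-init : ∀ {k} {x y : Point (suc k)} →
                Adjacent x y → ∣ last x - last y ∣ ≢ 1 → Adjacent (init x) (init y)
Adjacent-init {x = x} {y} adj ≢1 =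
  [ id , ⊥-elim ∘ ≢1 ]′ (∃-lookup-∷ʳ⁻ (λ u v → ∣ u - v ∣ ≡ 1) (init x) (init y)
    (subst₂ Adjacent (sym (init-∷ʳ-last x)) (sym (init-∷ʳ-last y)) adj))

InBoundary-init : ∀ {k} (ns : Vec ℕ k) m {x : Point (suc k)} → InBoundary (ns ∷ʳ m) x →
                  ¬ (last x ≡ 1 ⊎ last x ≡ 2 * m) → InBoundary ns (init x)
InBoundary-init ns m {x} x∈∂ ¬face =
  let box , face = subst (InBoundary (ns ∷ʳ m)) (sym (init-∷ʳ-last x)) x∈∂
  in ∀-lookup-∷ʳ⁻ (λ u n → 1 ≤ u × u ≤ 2 * n) (init x) ns box ,
     [ id , ⊥-elim ∘ ¬face ]′ (∃-lookup-∷ʳ⁻ (λ u n → u ≡ 1 ⊎ u ≡ 2 * n) (init x) ns face)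

headParity : ∀ {k} → Point (suc k) → Parity
headParity x = parity (head x)

sameHeadParity⇒Adjacent-tail : ∀ {k} {x y : Point (suc k)} → headParity x ≡ headParity y →
                               Adjacent x y → Adjacent (tail x) (tail y)
sameHeadParity⇒Adjacent-tail {x = x} {y} same adj =
  Adjacent-tail {x = x} {y} adj (λ d → ∣m-n∣≡1⇒parity≢ (head x) (head y) d same)

length-Clique≤2^ : ∀ {k} {xs : List (Point k)} → Clique xs → length xs ≤ 2 ^ k
length-Clique≤2^ {zero}  []                   = z≤n
length-Clique≤2^ {zero}  ([] ∷ [])            = s≤s z≤n
length-Clique≤2^ {zero}  (((() , _) ∷ _) ∷ _)
length-Clique≤2^ {suc k} {xs} clique = begin
  length xs                               ≡⟨ sym (length-colourClasses headParity xs) ⟩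
  length (class 0ℙ) + length (class 1ℙ)  ≤⟨ +-mono-≤ (≤2^k 0ℙ) (≤2^k 1ℙ) ⟩
  2 ^ k + 2 ^ k                           ≡⟨ sym (2^suc≡2^+2^ k) ⟩
  2 ^ suc k                               ∎
  where
  open ≤-Reasoning
  class : Parity → List (Point (suc k))
  class p = colourClass headParity p xs
  ≤2^k : ∀ p → length (class p) ≤ 2 ^ k
  ≤2^k p = subst (_≤ 2 ^ k) (length-map tail (class p)) (length-Clique≤2^
    (AllPairs-map-colourClass headParity tail p (λ {x} {y} → sameHeadParity⇒Adjacent-tail {x = x} {y})
                              clique))

Unique∧∼⇒Clique : ∀ {k} {S : List (Point k)} → Unique S → All (λ x → All (x ∼_) S) S → Clique S
Unique∧∼⇒Clique unique pairwise =
  AllPairs.zipWith (λ (x≢y , x∼y) → [ ⊥-elim ∘ x≢y , id ]′ x∼y) (unique , AllAll⇒AllPairs pairwise)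

Clique⇒Good : ∀ {k} (ns : Vec ℕ k) {S} → Clique S → length S ≡ 2 ^ k → All (InBoundary ns) S → Good ns
Clique⇒Good ns {S} clique |S|≡2^k S⊆∂ =
  S , AllPairs.map Adjacent⇒≢ clique , |S|≡2^k , S⊆∂ ,
  AllPairs⇒AllAll (inj₁ refl) ∼-sym (AllPairs.map inj₂ clique)
  where
  ∼-sym : Symmetric _∼_
  ∼-sym {x} {y} = Sum.map sym (Adjacent-sym {x = x} {y})

lastColour : ∀ {k} → ℕ → Point (suc k) → Parity
lastColour c x = parity (punchIn c (last x))

sameLastColour⇒Adjacent-init : ∀ {k} c {x y : Point (suc k)} → lastColour c x ≡ lastColour c y →
                               (c ≢ last x × c ≢ last y) × Adjacent x y → Adjacent (init x) (init y)
sameLastColour⇒Adjacent-init c {x} {y} same ((c≢x , c≢y) , adj) = Adjacent-init {x = x} {y} adj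
  (λ d → ∣m-n∣≡1⇒parity≢ (punchIn c (last x)) (punchIn c (last y)) (punchIn-∣-∣≡1 c c≢x c≢y d) same)

evenLastColour⇒InBoundary-init : ∀ {k} (ns : Vec ℕ k) m {c} → 1 ≤ c → c ≤ 2 * m →
  ∀ {x} → lastColour c x ≡ 0ℙ → InBoundary (ns ∷ʳ m) x × c ≢ last x → InBoundary ns (init x)
evenLastColour⇒InBoundary-init ns m 1≤c c≤2m even (x∈∂ , c≢x) = InBoundary-init ns m x∈∂ λ face →
  contradiction (trans (sym even) (parity-punchIn-face m 1≤c c≤2m c≢x face)) λ ()

avoidingClique⇒Good : ∀ {k} (ns : Vec ℕ k) m c → 1 ≤ c → c ≤ 2 * m →
                      ∀ {S} → Clique S → length S ≡ 2 ^ suc k →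
                      All (InBoundary (ns ∷ʳ m)) S → All (λ x → c ≢ last x) S → Good ns
avoidingClique⇒Good {k} ns m c 1≤c c≤2m {S} clique |S|≡2^1+k S⊆∂ avoid =
  Clique⇒Good ns (projectedClique 0ℙ)
    (trans (length-map init (class 0ℙ)) (m+n≡o+o⇒m≡o (≤2^k 0ℙ) (≤2^k 1ℙ) |class₀|+|class₁|≡2^k+2^k))
    (All-map-colourClass (lastColour c) init 0ℙ (evenLastColour⇒InBoundary-init ns m 1≤c c≤2m)
                         (All.zip (S⊆∂ , avoid)))
  where
  class : Parity → List (Point (suc k))
  class p = colourClass (lastColour c) p S
  projectedClique : ∀ p → Clique (map init (class p))
  projectedClique p = AllPairs-map-colourClass (lastColour c) init p (sameLastColour⇒Adjacent-init c)
                        (AllPairs.zip (All⇒AllPairs avoid , clique))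
  ≤2^k : ∀ p → length (class p) ≤ 2 ^ k
  ≤2^k p = subst (_≤ 2 ^ k) (length-map init (class p)) (length-Clique≤2^ (projectedClique p))
  |class₀|+|class₁|≡2^k+2^k : length (class 0ℙ) + length (class 1ℙ) ≡ 2 ^ k + 2 ^ k
  |class₀|+|class₁|≡2^k+2^k =
    trans (length-colourClasses (lastColour c) S) (trans |S|≡2^1+k (2^suc≡2^+2^ k))

proposition3p2 : (k : ℕ) (ns : Vec ℕ k) (m : ℕ) →
    AllPos ns → 1 ≤ m →
    Good (ns ∷ʳ m) → 2 ^ k < m → Good ns
proposition3p2 k ns m _ _ (S , unique , |S|≡2^1+k , S⊆∂ , pairwise) 2^k<m =
  let c , 1≤c , c≤2m , c∉ = length<⇒∃∉ (2 * m) (map last S) |lastCoordinates|<2m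
  in avoidingClique⇒Good ns m c 1≤c c≤2m (Unique∧∼⇒Clique unique pairwise) |S|≡2^1+k S⊆∂
     (All.map⁻ (¬Any⇒All¬ (map last S) c∉))
  where
  open ≤-Reasoning
  |lastCoordinates|<2m : length (map last S) < 2 * m
  |lastCoordinates|<2m = begin-strict
    length (map last S) ≡⟨ length-map last S ⟩
    length S            ≡⟨ |S|≡2^1+k ⟩
    2 * 2 ^ k           <⟨ *-monoʳ-< 2 2^k<m ⟩
    2 * m               ∎
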